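{- Let $n\ge1$ and let $K$ be a pure $n$-simplicial complex. If $K$ contains an $(n-1,n)$-circuit sequence, then $K$ contains an $(n-1,n)$-simplicial cycle sequence.
   Context: A simplicial complex on a finite vertex set is a collection of non-empty vertex subsets containing all singletons and closed under non-empty subsets; a $k$-simplex has $k+1$ vertices; $\tau$ is a face of $\sigma$ if $\tau\subseteq\sigma$. $K$ is a pure $n$-simplicial complex if $\dim K=n$ and every simplex is a face of some $n$-simplex. An $(n-1,n)$-walk sequence is an alternating sequence $\sigma_1,\eta_1,\sigma_2,\dots,\sigma_r,\eta_r,\sigma_{r+1}$ of $(n-1)$-simplices $\sigma_k$ and $n$-simplices $\eta_k$ with $\sigma_k\ne\sigma_{k+1}$ both faces of $\eta_k$. It is an $(n-1,n)$-circuit sequence if $\sigma_{r+1}=\sigma_1$ and $\sigma_p\ne\sigma_q$, $\eta_p\ne\eta_q$ for all $1\le p\ne q\le r$. An $(n-1,n)$-circuit sequence is an $(n-1,n)$-simplicial cycle sequence if moreover $r\ge3$, $\sigma_1$ is not a face of $\eta_k$ for $2\le k\le r-1$, and for each $2\le z\le r$ there is an $(n-1)$-simplex $\sigma'_z$ which is a face of $\eta_{z-1}$ and $\eta_z$ and has $\sigma_z$ as a face, with $\sigma'_x\ne\sigma'_y$ for $2\le x\ne y\le r$. -}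

module Defs where

open import Data.Nat using (ℕ; zero; suc; _≤_; _∸_)
open import Data.Fin using (Fin)
open import Data.Fin.Subset using (Subset; _⊆_; ⁅_⁆; Nonempty; ∣_∣)
open import Data.Product using (Σ; _×_; ∃-syntax)
open import Relation.Binary.PropositionalEquality using (_≡_; _≢_)
open import Relation.Nullary using (¬_)
open import Level using (Level; suc; _⊔_)

record SimplicialComplex (m : ℕ) : Set₁ where
  field
    simplex     : Subset m → Set
    nonempty    : ∀ σ → simplex σ → Nonempty σ
    singletons  : ∀ (v : Fin m) → simplex ⁅ v ⁆
    downClosed  : ∀ σ τ → simplex σ → Nonempty τ → τ ⊆ σ → simplex τ
open SimplicialComplex public

module _ {m : ℕ} (K : SimplicialComplex m) where

  IsSimplex : ℕ → Subset m → Set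
  IsSimplex k σ = simplex K σ × ∣ σ ∣ ≡ ℕ.suc k

  HasDim : ℕ → Set
  HasDim n = (∃[ η ] IsSimplex n η) × (∀ σ → simplex K σ → ∣ σ ∣ ≤ ℕ.suc n)

  IsPure : ℕ → Set
  IsPure n = HasDim n × (∀ σ → simplex K σ → ∃[ η ] (IsSimplex n η × σ ⊆ η))

  -- An (n-1,n)-walk sequence σ_1,η_1,…,σ_r,η_r,σ_{r+1}, indexed from 1
  -- (values of σ, η outside the index ranges are irrelevant). r ≥ 1.
  record IsWalkSeq (n r : ℕ) (σ η : ℕ → Subset m) : Set where
    field
      r≥1      : 1 ≤ r
      σ-simp   : ∀ k → 1 ≤ k → k ≤ ℕ.suc r → IsSimplex (n ∸ 1) (σ k)
      η-simp   : ∀ k → 1 ≤ k → k ≤ r → IsSimplex n (η k)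
      σ-distinct-step : ∀ k → 1 ≤ k → k ≤ r → σ k ≢ σ (ℕ.suc k)
      σ-face   : ∀ k → 1 ≤ k → k ≤ r → σ k ⊆ η k
      σ'-face  : ∀ k → 1 ≤ k → k ≤ r → σ (ℕ.suc k) ⊆ η k

  record IsCircuitSeq (n r : ℕ) (σ η : ℕ → Subset m) : Set where
    field
      walk    : IsWalkSeq n r σ η
      closed  : σ (ℕ.suc r) ≡ σ 1
      σ-inj   : ∀ p q → 1 ≤ p → p ≤ r → 1 ≤ q → q ≤ r → p ≢ q → σ p ≢ σ q
      η-inj   : ∀ p q → 1 ≤ p → p ≤ r → 1 ≤ q → q ≤ r → p ≢ q → η p ≢ η q

  record IsSimplicialCycleSeq (n r : ℕ) (σ η : ℕ → Subset m) : Set where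
    field
      circuit : IsCircuitSeq n r σ η
      r≥3     : 3 ≤ r
      σ₁-not-face : ∀ k → 2 ≤ k → k ≤ r ∸ 1 → ¬ (σ 1 ⊆ η k)
      σ'      : ℕ → Subset m
      σ'-simp : ∀ z → 2 ≤ z → z ≤ r → IsSimplex (n ∸ 1) (σ' z)
      σ'-faceˡ : ∀ z → 2 ≤ z → z ≤ r → σ' z ⊆ η (z ∸ 1)
      σ'-faceʳ : ∀ z → 2 ≤ z → z ≤ r → σ' z ⊆ η z
      σ-sub-σ' : ∀ z → 2 ≤ z → z ≤ r → σ z ⊆ σ' z
      σ'-inj  : ∀ x y → 2 ≤ x → x ≤ r → 2 ≤ y → y ≤ r → x ≢ y → σ' x ≢ σ' y

  HasCircuitSeq : ℕ → Set
  HasCircuitSeq n = ∃[ r ] ∃[ σ ] ∃[ η ] IsCircuitSeq n r σ η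

  HasSimplicialCycleSeq : ℕ → Set
  HasSimplicialCycleSeq n = ∃[ r ] ∃[ σ ] ∃[ η ] IsSimplicialCycleSeq n r σ η

-- Let σ₁, η₁, …, σᵣ, ηᵣ, σ₁ be a circuit and let k ≥ 2 be least with σ₁ ⊆ ηₖ
-- (k ≤ r, since σ₁ = σᵣ₊₁ ⊆ ηᵣ). Closing the walk at ηₖ gives a shorter circuit
-- σ₁, η₁, …, σₖ, ηₖ, σ₁ in which σ₁ is a face of no ηⱼ with 2 ≤ j < k, and taking
-- σ'_z := σ_z makes it a simplicial cycle once k ≥ 3. And k ≠ 2: otherwise the
-- distinct (n-1)-simplices σ₁ and σ₂ would both be faces of η₁ and η₂, and two
-- n-simplices sharing two distinct facets coincide (both equal σ₁ ∪ σ₂).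
module Submission where

open import Defs
open import Data.Nat using (ℕ; zero; suc; _≤_; _<_; _∸_; pred; z≤n; s≤s; _≤?_; _<?_)
open import Data.Nat.Properties
  using (≤-refl; ≤-trans; ≤-pred; <-≤-trans; ≮⇒≥; ≤∧≢⇒<; m≤n⇒m≤1+n; m≤n⇒m<n∨m≡n; n≮n; <⇒≱; anyUpTo?)
open import Data.Fin.Subset using (Subset; _⊆_; _∪_; ∣_∣; outside; inside)
open import Data.Fin.Subset.Properties
  using (_⊆?_; drop-∷-⊆; p⊆q⇒∣p∣≤∣q∣; p⊆p∪q; q⊆p∪q; x∈p∪q⁻)
open import Data.Vec using ([]; _∷_; here)
open import Data.Product using (_×_; _,_; ∃-syntax; proj₂)
open import Data.Sum using (inj₁; inj₂; [_,_]′)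
open import Relation.Nullary using (¬_; yes; no; contradiction; _×-dec_)
open import Relation.Unary using (Decidable)
open import Relation.Binary.PropositionalEquality
  using (_≡_; _≢_; refl; sym; trans; cong; subst; subst₂)

p⊆q∧∣q∣≤∣p∣⇒p≡q : ∀ {k} {p q : Subset k} → p ⊆ q → ∣ q ∣ ≤ ∣ p ∣ → p ≡ q
p⊆q∧∣q∣≤∣p∣⇒p≡q {p = []}          {[]}          _   _ = refl
p⊆q∧∣q∣≤∣p∣⇒p≡q {p = outside ∷ p} {outside ∷ q} p⊆q ∣q∣≤∣p∣ =
  cong (outside ∷_) (p⊆q∧∣q∣≤∣p∣⇒p≡q (drop-∷-⊆ p⊆q) ∣q∣≤∣p∣)
p⊆q∧∣q∣≤∣p∣⇒p≡q {p = outside ∷ p} {inside  ∷ q} p⊆q ∣q∣≤∣p∣ =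
  contradiction ∣q∣≤∣p∣ (<⇒≱ (s≤s (p⊆q⇒∣p∣≤∣q∣ (drop-∷-⊆ p⊆q))))
p⊆q∧∣q∣≤∣p∣⇒p≡q {p = inside  ∷ p} {outside ∷ q} p⊆q _ with p⊆q here
... | ()
p⊆q∧∣q∣≤∣p∣⇒p≡q {p = inside  ∷ p} {inside  ∷ q} p⊆q (s≤s ∣q∣≤∣p∣) =
  cong (inside ∷_) (p⊆q∧∣q∣≤∣p∣⇒p≡q (drop-∷-⊆ p⊆q) ∣q∣≤∣p∣)

module _ {k a : ℕ} {p q r : Subset k} where

  ∪-least : p ⊆ r → q ⊆ r → p ∪ q ⊆ r
  ∪-least p⊆r q⊆r x∈p∪q = [ p⊆r , q⊆r ]′ (x∈p∪q⁻ p q x∈p∪q)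

  ∣p∣≡∣q∣∧p≢q⇒∣p∣<∣p∪q∣ : ∣ p ∣ ≡ a → ∣ q ∣ ≡ a → p ≢ q → a < ∣ p ∪ q ∣
  ∣p∣≡∣q∣∧p≢q⇒∣p∣<∣p∪q∣ ∣p∣≡a ∣q∣≡a p≢q with a <? ∣ p ∪ q ∣
  ... | yes a<∣p∪q∣ = a<∣p∪q∣
  ... | no  a≮∣p∪q∣ = contradiction (trans p≡p∪q (sym q≡p∪q)) p≢q
    where
    p≡p∪q : p ≡ p ∪ q
    p≡p∪q = p⊆q∧∣q∣≤∣p∣⇒p≡q (p⊆p∪q q) (subst (∣ p ∪ q ∣ ≤_) (sym ∣p∣≡a) (≮⇒≥ a≮∣p∪q∣))
    q≡p∪q : q ≡ p ∪ q
    q≡p∪q = p⊆q∧∣q∣≤∣p∣⇒p≡q (q⊆p∪q p q) (subst (∣ p ∪ q ∣ ≤_) (sym ∣q∣≡a) (≮⇒≥ a≮∣p∪q∣))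

  distinct-facets-span : ∣ p ∣ ≡ a → ∣ q ∣ ≡ a → ∣ r ∣ ≡ suc a →
    p ≢ q → p ⊆ r → q ⊆ r → p ∪ q ≡ r
  distinct-facets-span ∣p∣≡a ∣q∣≡a ∣r∣≡1+a p≢q p⊆r q⊆r =
    p⊆q∧∣q∣≤∣p∣⇒p≡q (∪-least p⊆r q⊆r)
      (subst (_≤ ∣ p ∪ q ∣) (sym ∣r∣≡1+a) (∣p∣≡∣q∣∧p≢q⇒∣p∣<∣p∪q∣ ∣p∣≡a ∣q∣≡a p≢q))

module _ {p} {P : ℕ → Set p} (P? : Decidable P) where

  least-witness : ∀ n → ∃[ j ] (j ≤ n × P j) →
    ∃[ k ] (k ≤ n × P k × (∀ {j} → j < k → ¬ P j))
  least-witness zero (_ , z≤n , P0) = zero , z≤n , P0 , λ ()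
  least-witness (suc n) (j , j≤1+n , Pj) with anyUpTo? P? (suc n)
  ... | yes (i , i<1+n , Pi) with least-witness n (i , ≤-pred i<1+n , Pi)
  ...   | k , k≤n , Pk , below-k = k , m≤n⇒m≤1+n k≤n , Pk , below-k
  least-witness (suc n) (j , j≤1+n , Pj) | no none =
    j , j≤1+n , Pj , λ i<j Pi → none (_ , <-≤-trans i<j j≤1+n , Pi)

≤pred⇒< : ∀ {j k} → 1 ≤ k → j ≤ pred k → j < k
≤pred⇒< {k = suc _} _ j≤k = s≤s j≤k

closeAt : ∀ {A : Set} → ℕ → (ℕ → A) → ℕ → A
closeAt k s i with i ≤? k
... | yes _ = s i
... | no  _ = s 1

module _ {A : Set} {k : ℕ} (s : ℕ → A) where

  closeAt-≤ : ∀ {i} → i ≤ k → closeAt k s i ≡ s i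
  closeAt-≤ {i} i≤k with i ≤? k
  ... | yes _   = refl
  ... | no  i≰k = contradiction i≤k i≰k

  closeAt-suc : closeAt k s (suc k) ≡ s 1
  closeAt-suc with suc k ≤? k
  ... | yes 1+k≤k = contradiction 1+k≤k (n≮n k)
  ... | no  _     = refl

module _ {m : ℕ} (K : SimplicialComplex m) {n r : ℕ} {σ η : ℕ → Subset m}
         (C : IsCircuitSeq K n r σ η) where
  open IsCircuitSeq C
  open IsWalkSeq walk

  circuit-length≥2 : 2 ≤ r
  circuit-length≥2 with r≥1
  ... | s≤s {n = zero}  z≤n = contradiction (sym closed) (σ-distinct-step 1 ≤-refl ≤-refl)
  ... | s≤s {n = suc _} z≤n = s≤s (s≤s z≤n)

  σ₁⊆η-last : σ 1 ⊆ η r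
  σ₁⊆η-last = subst (_⊆ η r) closed (σ'-face r r≥1 ≤-refl)

  shortcut : ∀ {k} → 2 ≤ k → k ≤ r → σ 1 ⊆ η k → IsCircuitSeq K n k (closeAt k σ) η
  shortcut {k} 2≤k k≤r σ₁⊆ηₖ = record
    { walk = record
      { r≥1             = 1≤k
      ; σ-simp          = simp
      ; η-simp          = λ i 1≤i i≤k → η-simp i 1≤i (≤-trans i≤k k≤r)
      ; σ-distinct-step = step
      ; σ-face          = λ i 1≤i i≤k →
          subst (_⊆ η i) (sym (closeAt-≤ σ i≤k)) (σ-face i 1≤i (≤-trans i≤k k≤r))
      ; σ'-face         = face
      }
    ; closed = trans (closeAt-suc {k = k} σ) (sym (closeAt-≤ σ 1≤k))
    ; σ-inj  = λ i j 1≤i i≤k 1≤j j≤k i≢j →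
        subst₂ _≢_ (sym (closeAt-≤ σ i≤k)) (sym (closeAt-≤ σ j≤k))
          (σ-inj i j 1≤i (≤-trans i≤k k≤r) 1≤j (≤-trans j≤k k≤r) i≢j)
    ; η-inj  = λ i j 1≤i i≤k 1≤j j≤k → η-inj i j 1≤i (≤-trans i≤k k≤r) 1≤j (≤-trans j≤k k≤r)
    }
    where
    1≤k : 1 ≤ k
    1≤k = ≤-trans (s≤s z≤n) 2≤k
    simp : ∀ i → 1 ≤ i → i ≤ suc k → IsSimplex K (n ∸ 1) (closeAt k σ i)
    simp i 1≤i i≤1+k with m≤n⇒m<n∨m≡n i≤1+k
    ... | inj₁ (s≤s i≤k) rewrite closeAt-≤ σ i≤k = σ-simp i 1≤i (≤-trans i≤1+k (s≤s k≤r))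
    ... | inj₂ refl      rewrite closeAt-suc {k = k} σ = σ-simp 1 ≤-refl (s≤s z≤n)
    σₖ≢σ₁ : σ k ≢ σ 1
    σₖ≢σ₁ = σ-inj k 1 1≤k k≤r ≤-refl (≤-trans 1≤k k≤r) λ { refl → contradiction 2≤k λ { (s≤s ()) } }
    step : ∀ i → 1 ≤ i → i ≤ k → closeAt k σ i ≢ closeAt k σ (suc i)
    step i 1≤i i≤k with m≤n⇒m<n∨m≡n i≤k
    ... | inj₁ i<k rewrite closeAt-≤ σ i≤k | closeAt-≤ σ i<k =
      σ-distinct-step i 1≤i (≤-trans i≤k k≤r)
    ... | inj₂ refl rewrite closeAt-≤ σ i≤k | closeAt-suc {k = k} σ =
      σₖ≢σ₁
    face : ∀ i → 1 ≤ i → i ≤ k → closeAt k σ (suc i) ⊆ η i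
    face i 1≤i i≤k with m≤n⇒m<n∨m≡n i≤k
    ... | inj₁ i<k  rewrite closeAt-≤ σ i<k = σ'-face i 1≤i (≤-trans i≤k k≤r)
    ... | inj₂ refl rewrite closeAt-suc {k = k} σ = σ₁⊆ηₖ

  circuit⇒simplicialCycle : 3 ≤ r → (∀ k → 2 ≤ k → k ≤ r ∸ 1 → ¬ σ 1 ⊆ η k) →
    IsSimplicialCycleSeq K n r σ η
  circuit⇒simplicialCycle 3≤r σ₁⊈ηₖ = record
    { circuit     = C
    ; r≥3         = 3≤r
    ; σ₁-not-face = σ₁⊈ηₖ
    ; σ'          = σ
    ; σ'-simp     = λ z 2≤z z≤r → σ-simp z (≤-trans (s≤s z≤n) 2≤z) (m≤n⇒m≤1+n z≤r)
    ; σ'-faceˡ    = λ { (suc z) (s≤s 1≤z) z<r → σ'-face z 1≤z (≤-trans (m≤n⇒m≤1+n ≤-refl) z<r) }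
    ; σ'-faceʳ    = λ z 2≤z z≤r → σ-face z (≤-trans (s≤s z≤n) 2≤z) z≤r
    ; σ-sub-σ'    = λ _ _ _ x∈σ → x∈σ
    ; σ'-inj      = λ x y 2≤x x≤r 2≤y y≤r →
        σ-inj x y (≤-trans (s≤s z≤n) 2≤x) x≤r (≤-trans (s≤s z≤n) 2≤y) y≤r
    }

module _ {m : ℕ} (K : SimplicialComplex m) {n r : ℕ} {σ η : ℕ → Subset m}
         (C : IsCircuitSeq K (suc n) r σ η) where
  open IsCircuitSeq C
  open IsWalkSeq walk

  σ₁⊈η₂ : ¬ σ 1 ⊆ η 2
  σ₁⊈η₂ σ₁⊆η₂ = η-inj 1 2 ≤-refl 1≤r (s≤s z≤n) 2≤r (λ ()) (trans (sym σ₁∪σ₂≡η₁) σ₁∪σ₂≡η₂)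
    where
    2≤r : 2 ≤ r
    2≤r = circuit-length≥2 K C
    1≤r : 1 ≤ r
    1≤r = ≤-trans (s≤s z≤n) 2≤r
    ∣σ₁∣ : ∣ σ 1 ∣ ≡ suc n
    ∣σ₁∣ = proj₂ (σ-simp 1 ≤-refl (s≤s z≤n))
    ∣σ₂∣ : ∣ σ 2 ∣ ≡ suc n
    ∣σ₂∣ = proj₂ (σ-simp 2 (s≤s z≤n) (s≤s 1≤r))
    σ₁≢σ₂ : σ 1 ≢ σ 2
    σ₁≢σ₂ = σ-distinct-step 1 ≤-refl 1≤r
    σ₁∪σ₂≡η₁ : σ 1 ∪ σ 2 ≡ η 1
    σ₁∪σ₂≡η₁ = distinct-facets-span ∣σ₁∣ ∣σ₂∣ (proj₂ (η-simp 1 ≤-refl 1≤r)) σ₁≢σ₂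
      (σ-face 1 ≤-refl 1≤r) (σ'-face 1 ≤-refl 1≤r)
    σ₁∪σ₂≡η₂ : σ 1 ∪ σ 2 ≡ η 2
    σ₁∪σ₂≡η₂ = distinct-facets-span ∣σ₁∣ ∣σ₂∣ (proj₂ (η-simp 2 (s≤s z≤n) 2≤r)) σ₁≢σ₂
      σ₁⊆η₂ (σ-face 2 (s≤s z≤n) 2≤r)

corollary4p2 : (m n : ℕ) → 1 ≤ n → (K : SimplicialComplex m) → IsPure K n →
    HasCircuitSeq K n → HasSimplicialCycleSeq K n
corollary4p2 m zero () K
corollary4p2 m n@(suc _) _ K _ (r , σ , η , C)
  with least-witness (λ j → 2 ≤? j ×-dec σ 1 ⊆? η j) r
         (r , ≤-refl , circuit-length≥2 K C , σ₁⊆η-last K C)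
... | k , k≤r , (2≤k , σ₁⊆ηₖ) , below-k =
  k , closeAt k σ , η , circuit⇒simplicialCycle K (shortcut K C 2≤k k≤r σ₁⊆ηₖ) 3≤k σ₁⊈ηⱼ
  where
  3≤k : 3 ≤ k
  3≤k = ≤∧≢⇒< 2≤k λ { refl → σ₁⊈η₂ K C σ₁⊆ηₖ }
  σ₁⊈ηⱼ : ∀ j → 2 ≤ j → j ≤ k ∸ 1 → ¬ closeAt k σ 1 ⊆ η j
  σ₁⊈ηⱼ j 2≤j j≤k-1 rewrite closeAt-≤ {k = k} σ (≤-trans (s≤s z≤n) 2≤k) =
    λ σ₁⊆ηⱼ → below-k (≤pred⇒< (≤-trans (s≤s z≤n) 2≤k) j≤k-1) (2≤j , σ₁⊆ηⱼ)
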